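{- Let $G$ be a graph with $15$ vertices and let $u\in V(G)$ with $\deg_G(u)=6$. If $G$ is $3$-non-compliant, then $$\sum_{v\in N_G(u)}\deg_G(v)\ge 42.$$
   Context: All graphs are finite, simple and undirected; $\overline{G}$ denotes the complement of $G$; $N_G(u)$ is the set of vertices adjacent to $u$. A minor of $G$ is a graph obtained from $G$ by a sequence of vertex deletions, edge deletions and edge contractions. $\Delta(H)$ is the maximum degree of $H$. A graph $G$ on $n$ vertices is $3$-non-compliant if neither $G$ nor $\overline{G}$ has a minor $H$ with $\Delta(H)\ge n-3$. -}

module Defs where

open import Data.Nat using (ℕ; zero; suc; _+_; _≤_; _∸_)
open import Data.Bool using (Bool; true; false; _∧_; _∨_; not; if_then_else_)
open import Data.Fin using (Fin; punchIn; _≟_)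
open import Data.List using (List; map; allFin)
open import Data.Nat.ListAction using (sum)
open import Data.Product using (Σ; ∃; _×_)
open import Relation.Nullary using (¬_)
open import Relation.Nullary.Decidable using (⌊_⌋)
open import Relation.Binary.PropositionalEquality using (_≡_; _≢_)

Adj : ℕ → Set
Adj n = Fin n → Fin n → Bool

IsSimple : ∀ {n} → Adj n → Set
IsSimple {n} G = (∀ (x y : Fin n) → G x y ≡ G y x) × (∀ (x : Fin n) → G x x ≡ false)

_==_ : ∀ {n} → Fin n → Fin n → Bool
x == y = ⌊ x ≟ y ⌋

complement : ∀ {n} → Adj n → Adj n
complement G x y = not (G x y) ∧ not (x == y)

deg : ∀ {n} → Adj n → Fin n → ℕ
deg {n} G v = sum (map (λ w → if G v w then 1 else 0) (allFin n))

neighbourDegSum : ∀ {n} → Adj n → Fin n → ℕ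
neighbourDegSum {n} G u = sum (map (λ w → if G u w then deg G w else 0) (allFin n))

deleteVertex : ∀ {n} → Adj (suc n) → Fin (suc n) → Adj n
deleteVertex G v i j = G (punchIn v i) (punchIn v j)

deleteEdge : ∀ {n} → Adj n → Fin n → Fin n → Adj n
deleteEdge G a b x y = G x y ∧ not ((x == a ∧ y == b) ∨ (x == b ∧ y == a))

-- Contract the edge ab: b is merged into a (and removed), no loops / multi-edges.
contract : ∀ {n} → Adj (suc n) → Fin (suc n) → Fin (suc n) → Adj n
contract G a b i j =
  (G i' j' ∨ ((i' == a) ∧ G b j') ∨ ((j' == a) ∧ G i' b)) ∧ not (i == j)
  where
    i' = punchIn b i
    j' = punchIn b j

data Minor : ∀ {m n} → Adj m → Adj n → Set where
  done : ∀ {n} {G : Adj n} → Minor G G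
  delV : ∀ {m n} {H : Adj m} {G : Adj (suc n)} (v : Fin (suc n)) →
         Minor H (deleteVertex G v) → Minor H G
  delE : ∀ {m n} {H : Adj m} {G : Adj n} (a b : Fin n) →
         G a b ≡ true → Minor H (deleteEdge G a b) → Minor H G
  contr : ∀ {m n} {H : Adj m} {G : Adj (suc n)} (a b : Fin (suc n)) →
          a ≢ b → G a b ≡ true → Minor H (contract G a b) → Minor H G

MaxDegAtLeast : ∀ {m} → Adj m → ℕ → Set
MaxDegAtLeast {m} H k = ∃ λ (v : Fin m) → k ≤ deg H v

HasMinorWithMaxDeg : ∀ {n} → Adj n → ℕ → Set
HasMinorWithMaxDeg G k = Σ ℕ λ m → Σ (Adj m) λ H → Minor H G × MaxDegAtLeast H k

NonCompliant3 : ∀ {n} → Adj n → Set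
NonCompliant3 {n} G =
  ¬ HasMinorWithMaxDeg G (n ∸ 3) × ¬ HasMinorWithMaxDeg (complement G) (n ∸ 3)

{-# OPTIONS --safe #-}
module Submission where

-- Write c(t) for the number of common neighbours of u and t. Double counting gives
-- Σ_{v ∈ N(u)} deg v = Σ_t c(t), and c(u) = deg u. If three vertices span a connected
-- subgraph dominating a graph on n vertices, contracting them yields a vertex adjacent to
-- all n − 3 others; so neither G nor its complement has such a triple. Applying this to
-- triples through u, in G and in the complement, gives c(x) ≥ 2 for every neighbour x of u
-- and c(w) ≥ 3 for every non-neighbour w ≠ u, as soon as deg u ≥ 2. Hence
-- Σ_t c(t) = Σ_{t ≠ u} ([t ∈ N(u)] + c(t)) ≥ 3 (n − 1), which is 42 for n = 15.

open import Defs
open import Data.Nat using (_≤_)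
open import Data.Fin using (Fin)
open import Relation.Binary.PropositionalEquality using (_≡_)

open import Data.Nat.Properties
  using (+-0-commutativeMonoid; +-mono-≤; m≤n+m; ≤-trans; ≤-reflexive; *-identityʳ; module ≤-Reasoning)
open import Algebra.Properties.CommutativeMonoid.Sum +-0-commutativeMonoid
  using (sum; sum-remove; ∑-distrib-+; ∑-comm; sum-cong-≗; sum-replicate-zero)
open import Data.Bool using (Bool; true; false; _∧_; _∨_; not; if_then_else_)
  renaming (_≟_ to _≟ᵇ_)
open import Data.Bool.Properties using (∨-conicalˡ; ∨-conicalʳ; ∧-idem; ¬-not)
open import Data.Empty using (⊥-elim)
open import Data.Fin using (zero; suc; punchIn; punchOut; _≟_)
open import Data.Fin.Properties
  using (any?; punchIn-punchOut; punchInᵢ≢i; punchIn-injective; punchOut-injective)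
open import Data.List using (allFin; map; tabulate)
open import Data.List.Properties using (map-tabulate)
import Data.Nat.ListAction as List
open import Data.Nat using (ℕ; zero; suc; _+_; _*_; z≤n; s≤s; s≤s⁻¹)
open import Data.Product using (∃; ∃₂; _×_; _,_; proj₁; proj₂)
open import Data.Sum using (_⊎_; inj₁; inj₂; [_,_]′)
open import Function using (_∘_; id)
open import Relation.Nullary using (¬_; yes; no; ¬?)
open import Relation.Nullary.Decidable using (isYes≗does; dec-true; dec-false; _×-dec_)
open import Relation.Binary.PropositionalEquality
  using (_≢_; refl; sym; trans; cong; subst; ≢-sym; module ≡-Reasoning)

indicator : Bool → ℕ
indicator b = if b then 1 else 0

count : ∀ {n} → (Fin n → Bool) → ℕ
count f = sum (indicator ∘ f)

codegree : ∀ {n} → Adj n → Fin n → Fin n → ℕ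
codegree G u t = count (λ v → G u v ∧ G v t)

listSum-tabulate : ∀ {n} (f : Fin n → ℕ) → List.sum (tabulate f) ≡ sum f
listSum-tabulate {zero}  f = refl
listSum-tabulate {suc n} f = cong (f zero +_) (listSum-tabulate (f ∘ suc))

listSum-allFin : ∀ {n} (f : Fin n → ℕ) → List.sum (map f (allFin n)) ≡ sum f
listSum-allFin f = trans (cong List.sum (map-tabulate id f)) (listSum-tabulate f)

deg≡count : ∀ {n} (G : Adj n) v → deg G v ≡ count (G v)
deg≡count G v = listSum-allFin (indicator ∘ G v)

n*k≤sum : ∀ {n k} (f : Fin n → ℕ) → (∀ i → k ≤ f i) → n * k ≤ sum f
n*k≤sum {zero}  f k≤f = z≤n
n*k≤sum {suc n} f k≤f = +-mono-≤ (k≤f zero) (n*k≤sum (f ∘ suc) (k≤f ∘ suc))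

count-split : ∀ {n} (f : Fin (suc n) → Bool) a →
              count f ≡ indicator (f a) + count (f ∘ punchIn a)
count-split f a = sum-remove {i = a} (indicator ∘ f)

count-remove : ∀ {n} (f : Fin (suc n) → Bool) {a} → f a ≡ true → count f ≡ suc (count (f ∘ punchIn a))
count-remove f {a} fa =
  trans (count-split f a) (cong (λ b → indicator b + count (f ∘ punchIn a)) fa)

count-punchIn : ∀ {n k} (f : Fin (suc n) → Bool) {a} → f a ≡ true →
                k ≤ count (f ∘ punchIn a) → suc k ≤ count f
count-punchIn f fa k≤ = ≤-trans (s≤s k≤) (≤-reflexive (sym (count-remove f fa)))

true-at-punchOut : ∀ {n} (f : Fin (suc n) → Bool) {a b} (a≢b : a ≢ b) → f b ≡ true →
                   (f ∘ punchIn a) (punchOut a≢b) ≡ true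
true-at-punchOut f a≢b fb = subst (λ x → f x ≡ true) (sym (punchIn-punchOut a≢b)) fb

1≤count : ∀ {n} (f : Fin n → Bool) {a} → f a ≡ true → 1 ≤ count f
1≤count {suc n} f fa = count-punchIn f fa z≤n

2≤count : ∀ {n} (f : Fin n → Bool) {a b} → a ≢ b → f a ≡ true → f b ≡ true → 2 ≤ count f
2≤count {suc n} f a≢b fa fb = count-punchIn f fa (1≤count (f ∘ punchIn _) (true-at-punchOut f a≢b fb))

3≤count : ∀ {n} (f : Fin n → Bool) {a b c} → a ≢ b → a ≢ c → b ≢ c →
          f a ≡ true → f b ≡ true → f c ≡ true → 3 ≤ count f
3≤count {suc n} f a≢b a≢c b≢c fa fb fc =
  count-punchIn f fa (2≤count (f ∘ punchIn _) (b≢c ∘ punchOut-injective a≢b a≢c)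
    (true-at-punchOut f a≢b fb) (true-at-punchOut f a≢c fc))

count-witness : ∀ {n} (f : Fin n → Bool) → 1 ≤ count f → ∃ λ a → f a ≡ true
count-witness {suc n} f 1≤ with f zero in fz
... | true  = zero , fz
... | false = let (a , fa) = count-witness (f ∘ suc) 1≤ in suc a , fa

count-other : ∀ {n} (f : Fin n → Bool) {a} → 2 ≤ count f → f a ≡ true → ∃ λ b → b ≢ a × f b ≡ true
count-other {suc n} f {a} 2≤ fa =
  let (j , fj) = count-witness (f ∘ punchIn a) (s≤s⁻¹ (≤-trans 2≤ (≤-reflexive (count-remove f fa))))
  in punchIn a j , punchInᵢ≢i a j , fj

count-two-witnesses : ∀ {n} (f : Fin n → Bool) → 2 ≤ count f →
                      ∃₂ λ a b → a ≢ b × f a ≡ true × f b ≡ true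
count-two-witnesses f 2≤ =
  let (a , fa) = count-witness f (≤-trans (s≤s z≤n) 2≤)
      (b , b≢a , fb) = count-other f 2≤ fa
  in a , b , ≢-sym b≢a , fa , fb

∨-introˡ : ∀ {x} y → x ≡ true → (x ∨ y) ≡ true
∨-introˡ y refl = refl

∨-introʳ : ∀ x {y} → y ≡ true → (x ∨ y) ≡ true
∨-introʳ true  _  = refl
∨-introʳ false yt = yt

∧-intro : ∀ {x y} → x ≡ true → y ≡ true → (x ∧ y) ≡ true
∧-intro refl refl = refl

separated : ∀ {A : Set} (f : A → Bool) {x y} → f x ≡ false → f y ≡ true → x ≢ y
separated f fx fy refl with trans (sym fx) fy
... | ()

==-refl : ∀ {n} (x : Fin n) → (x == x) ≡ true
==-refl x = trans (isYes≗does (x ≟ x)) (dec-true (x ≟ x) refl)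

≢⇒==-false : ∀ {n} {x y : Fin n} → x ≢ y → (x == y) ≡ false
≢⇒==-false {x = x} {y} x≢y = trans (isYes≗does (x ≟ y)) (dec-false (x ≟ y) x≢y)

punchIn≢ : ∀ {n} {i j : Fin (suc n)} (i≢j : i ≢ j) {q} → q ≢ punchOut i≢j → punchIn i q ≢ j
punchIn≢ {i = i} i≢j {q} q≢ eq = q≢ (punchIn-injective i q _ (trans eq (sym (punchIn-punchOut i≢j))))

contract-keeps-edge : ∀ {n} (G : Adj (suc n)) a b {p q} → p ≢ q →
                      G (punchIn b p) (punchIn b q) ≡ true → contract G a b p q ≡ true
contract-keeps-edge G a b {p} {q} p≢q e rewrite e | ≢⇒==-false p≢q = refl

contract-merges : ∀ {n} (G : Adj (suc n)) {a b} (b≢a : b ≢ a) {q} → q ≢ punchOut b≢a →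
                  (G a (punchIn b q) ∨ G b (punchIn b q)) ≡ true →
                  contract G a b (punchOut b≢a) q ≡ true
contract-merges G {a} {b} b≢a {q} q≢ e
  rewrite punchIn-punchOut b≢a | ≢⇒==-false (≢-sym q≢) | ==-refl a
  with G a (punchIn b q) | G b (punchIn b q)
... | true  | _    = refl
... | false | true = refl

contract-minor : ∀ {n k} {G : Adj (suc n)} {a b} → a ≢ b → G a b ≡ true →
                 HasMinorWithMaxDeg (contract G a b) k → HasMinorWithMaxDeg G k
contract-minor a≢b ab (m , H , H≼ , Δ) = m , H , contr _ _ a≢b ab H≼ , Δ

universal-vertex⇒minor : ∀ {n} (H : Adj (suc n)) v → (∀ q → q ≢ v → H v q ≡ true) →
                         HasMinorWithMaxDeg H n
universal-vertex⇒minor {n} H v adj = suc n , H , done , v , n≤deg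
  where
  1≤adj : ∀ j → 1 ≤ indicator (H v (punchIn v j))
  1≤adj j rewrite adj (punchIn v j) (punchInᵢ≢i v j) = s≤s z≤n

  n≤deg : n ≤ deg H v
  n≤deg = begin
    n                                              ≡⟨ *-identityʳ n ⟨
    n * 1                                          ≤⟨ n*k≤sum (indicator ∘ H v ∘ punchIn v) 1≤adj ⟩
    count (H v ∘ punchIn v)                        ≤⟨ m≤n+m _ _ ⟩
    indicator (H v v) + count (H v ∘ punchIn v)    ≡⟨ count-split (H v) v ⟨
    count (H v)                                    ≡⟨ deg≡count H v ⟨
    deg H v                                        ∎
    where open ≤-Reasoning

dominating-edge⇒minor : ∀ {n} (G : Adj (2 + n)) {a b} → a ≢ b → G a b ≡ true →
                        (∀ t → t ≢ a → t ≢ b → (G a t ∨ G b t) ≡ true) →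
                        HasMinorWithMaxDeg G n
dominating-edge⇒minor G {a} {b} a≢b ab dom =
  contract-minor a≢b ab (universal-vertex⇒minor (contract G a b) (punchOut b≢a) adj)
  where
  b≢a = ≢-sym a≢b
  adj : ∀ q → q ≢ punchOut b≢a → contract G a b (punchOut b≢a) q ≡ true
  adj q q≢ = contract-merges G b≢a q≢ (dom (punchIn b q) (punchIn≢ b≢a q≢) (punchInᵢ≢i b q))

connected-dominating-triple⇒minor : ∀ {n} (G : Adj (3 + n)) {a b c} → a ≢ b → a ≢ c → b ≢ c →
                        G a b ≡ true → (G a c ∨ G b c) ≡ true →
                        (∀ t → t ≢ a → t ≢ b → t ≢ c → ((G a t ∨ G b t) ∨ G c t) ≡ true) →
                        HasMinorWithMaxDeg G n
connected-dominating-triple⇒minor G {a} {b} {c} a≢b a≢c b≢c ab ac∨bc dom =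
  contract-minor a≢b ab (dominating-edge⇒minor (contract G a b) a₁≢c₁ a₁c₁ dom₁)
  where
  b≢a = ≢-sym a≢b
  a₁ = punchOut b≢a
  c₁ = punchOut b≢c

  a₁≢c₁ : a₁ ≢ c₁
  a₁≢c₁ = a≢c ∘ punchOut-injective b≢a b≢c

  a₁c₁ : contract G a b a₁ c₁ ≡ true
  a₁c₁ = contract-merges G b≢a (≢-sym a₁≢c₁)
           (subst (λ x → (G a x ∨ G b x) ≡ true) (sym (punchIn-punchOut b≢c)) ac∨bc)

  dom₁ : ∀ r → r ≢ a₁ → r ≢ c₁ → (contract G a b a₁ r ∨ contract G a b c₁ r) ≡ true
  dom₁ r r≢a₁ r≢c₁ with G a (punchIn b r) ∨ G b (punchIn b r) in ab-r
  ... | true  = ∨-introˡ _ (contract-merges G b≢a r≢a₁ ab-r)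
  ... | false = ∨-introʳ _ (contract-keeps-edge G a b (≢-sym r≢c₁)
                  (subst (λ x → G x (punchIn b r) ≡ true) (sym (punchIn-punchOut b≢c)) cr))
    where
    cr : G c (punchIn b r) ≡ true
    cr = subst (λ x → (x ∨ G c (punchIn b r)) ≡ true) ab-r
           (dom (punchIn b r) (punchIn≢ b≢a r≢a₁) (punchInᵢ≢i b r) (punchIn≢ b≢c r≢c₁))

undominated-vertex : ∀ {n} (G : Adj (3 + n)) → ¬ HasMinorWithMaxDeg G n →
                     ∀ {a b c} → a ≢ b → a ≢ c → b ≢ c →
                     G a b ≡ true → (G a c ∨ G b c) ≡ true →
                     ∃ λ t → (t ≢ a × t ≢ b × t ≢ c) × ((G a t ∨ G b t) ∨ G c t) ≡ false
undominated-vertex G ¬minor {a} {b} {c} a≢b a≢c b≢c ab ac∨bc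
  with any? (λ t → (¬? (t ≟ a) ×-dec ¬? (t ≟ b) ×-dec ¬? (t ≟ c))
                   ×-dec (((G a t ∨ G b t) ∨ G c t) ≟ᵇ false))
... | yes found = found
... | no none   = ⊥-elim (¬minor (connected-dominating-triple⇒minor G a≢b a≢c b≢c ab ac∨bc dominated))
  where
  dominated : ∀ t → t ≢ a → t ≢ b → t ≢ c → ((G a t ∨ G b t) ∨ G c t) ≡ true
  dominated t t≢a t≢b t≢c = ¬-not (λ e → none (t , (t≢a , t≢b , t≢c) , e))

∨₃-false : ∀ x y z → ((x ∨ y) ∨ z) ≡ false → x ≡ false × y ≡ false × z ≡ false
∨₃-false x y z e = let xy = ∨-conicalˡ (x ∨ y) z e in
  ∨-conicalˡ x y xy , ∨-conicalʳ x y xy , ∨-conicalʳ (x ∨ y) z e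

complement-edge : ∀ {n} (G : Adj n) {x y} → x ≢ y → G x y ≡ false → complement G x y ≡ true
complement-edge G x≢y e rewrite e | ≢⇒==-false x≢y = refl

complement-non-edge : ∀ {n} (G : Adj n) {x y} → x ≢ y → complement G x y ≡ false → G x y ≡ true
complement-non-edge G {x} {y} x≢y e rewrite ≢⇒==-false x≢y with G x y
... | true = refl

neighbourDegSum≡∑codegree : ∀ {n} (G : Adj n) u → neighbourDegSum G u ≡ sum (codegree G u)
neighbourDegSum≡∑codegree {n} G u = begin
  neighbourDegSum G u                        ≡⟨ listSum-allFin (λ w → if G u w then deg G w else 0) ⟩
  sum (λ w → if G u w then deg G w else 0)   ≡⟨ sum-cong-≗ neighbourTerm ⟩
  sum (λ w → count (λ t → G u w ∧ G w t))    ≡⟨ ∑-comm (λ w t → indicator (G u w ∧ G w t)) ⟩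
  sum (codegree G u)                         ∎
  where
  open ≡-Reasoning
  neighbourTerm : ∀ w → (if G u w then deg G w else 0) ≡ count (λ t → G u w ∧ G w t)
  neighbourTerm w with G u w
  ... | true  = deg≡count G w
  ... | false = sym (sum-replicate-zero n)

module _ {n} (G : Adj (3 + n)) (simple : IsSimple G) (nc : NonCompliant3 G) (u : Fin (3 + n)) where

  private
    G-sym : ∀ x y → G x y ≡ G y x
    G-sym = proj₁ simple

    adjacent⇒≢ : ∀ {x y} → G x y ≡ true → x ≢ y
    adjacent⇒≢ {x} xy refl with trans (sym xy) (proj₂ simple x)
    ... | ()

  common-non-neighbour : ∀ {x z} → G u x ≡ true → G u z ≡ true → x ≢ z →
                         ∃ λ w → w ≢ u × G u w ≡ false × G x w ≡ false × G z w ≡ false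
  common-non-neighbour ux uz x≢z =
    let (w , (w≢u , _) , undominated) =
          undominated-vertex G (proj₁ nc) (adjacent⇒≢ ux) (adjacent⇒≢ uz) x≢z ux (∨-introˡ _ uz)
        (uw , xw , zw) = ∨₃-false _ _ _ undominated
    in w , w≢u , uw , xw , zw

  common-neighbour : ∀ {b c} → b ≢ u → c ≢ u → b ≢ c → G u b ≡ false →
                     G u c ≡ false ⊎ G b c ≡ false →
                     ∃ λ y → G u y ≡ true × G y b ≡ true × G y c ≡ true
  common-neighbour {b} {c} b≢u c≢u b≢c ub uc⊎bc =
    let (y , (y≢u , y≢b , y≢c) , undominated) =
          undominated-vertex (complement G) (proj₂ nc) (≢-sym b≢u) (≢-sym c≢u) b≢c
            (complement-edge G (≢-sym b≢u) ub) complement-uc∨bc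
        (ūy , b̄y , c̄y) = ∨₃-false _ _ _ undominated
    in y , complement-non-edge G (≢-sym y≢u) ūy
         , trans (G-sym y b) (complement-non-edge G (≢-sym y≢b) b̄y)
         , trans (G-sym y c) (complement-non-edge G (≢-sym y≢c) c̄y)
    where
    complement-uc∨bc : (complement G u c ∨ complement G b c) ≡ true
    complement-uc∨bc = [ ∨-introˡ _ ∘ complement-edge G (≢-sym c≢u)
                       , ∨-introʳ _ ∘ complement-edge G b≢c ]′ uc⊎bc

  -- The neighbour a of u is needed only when v = w, as the third vertex of the triple.
  common-neighbour-of-non-neighbours :
    ∀ {w v a} → w ≢ u → G u w ≡ false → v ≢ u → G u v ≡ false → G u a ≡ true → G a v ≡ false →
    ∃ λ y → G u y ≡ true × G y w ≡ true × G y v ≡ true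
  common-neighbour-of-non-neighbours {w} {v} w≢u uw v≢u uv ua av with v ≟ w
  ... | yes refl =
    let (y , uy , yv , _) = common-neighbour v≢u (≢-sym (adjacent⇒≢ ua)) (separated (G u) uv ua) uv
                              (inj₂ (trans (G-sym v _) av))
    in y , uy , yv , yv
  ... | no v≢w = common-neighbour w≢u v≢u (≢-sym v≢w) uw (inj₁ uv)

  neighbour-codegree-step : ∀ {x z} → G u x ≡ true → G u z ≡ true → z ≢ x →
                            ∃ λ y → y ≢ z × G u y ≡ true × G y x ≡ true
  neighbour-codegree-step {x} ux uz z≢x =
    let (w , w≢u , uw , xw , zw) = common-non-neighbour ux uz (≢-sym z≢x)
        (y , uy , yw , yx) = common-neighbour w≢u (≢-sym (adjacent⇒≢ ux)) (separated (G u) uw ux) uw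
                               (inj₂ (trans (G-sym w x) xw))
    in y , ≢-sym (separated (λ t → G t w) zw yw) , uy , yx

  non-neighbour-codegree-step : ∀ {w a a′} → w ≢ u → G u w ≡ false → a ≢ a′ →
                                G u a ≡ true → G u a′ ≡ true →
                                ∃ λ y → y ≢ a × y ≢ a′ × G u y ≡ true × G y w ≡ true
  non-neighbour-codegree-step w≢u uw a≢a′ ua ua′ =
    let (v , v≢u , uv , av , a′v) = common-non-neighbour ua ua′ a≢a′
        (y , uy , yw , yv) = common-neighbour-of-non-neighbours w≢u uw v≢u uv ua av
    in y , ≢-sym (separated (λ t → G t v) av yv) , ≢-sym (separated (λ t → G t v) a′v yv) , uy , yw

  2≤codegree-neighbour : 2 ≤ deg G u → ∀ {x} → G u x ≡ true → 2 ≤ codegree G u x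
  2≤codegree-neighbour 2≤deg {x} ux =
    let (z , z≢x , uz) = count-other (G u) (≤-trans 2≤deg (≤-reflexive (deg≡count G u))) ux
        (y₁ , _ , uy₁ , y₁x) = neighbour-codegree-step ux uz z≢x
        (y₂ , y₂≢y₁ , uy₂ , y₂x) = neighbour-codegree-step ux uy₁ (adjacent⇒≢ y₁x)
    in 2≤count (λ v → G u v ∧ G v x) (≢-sym y₂≢y₁) (∧-intro uy₁ y₁x) (∧-intro uy₂ y₂x)

  3≤codegree-non-neighbour : 2 ≤ deg G u → ∀ {w} → w ≢ u → G u w ≡ false → 3 ≤ codegree G u w
  3≤codegree-non-neighbour 2≤deg {w} w≢u uw =
    let (a , a′ , a≢a′ , ua , ua′) =
          count-two-witnesses (G u) (≤-trans 2≤deg (≤-reflexive (deg≡count G u)))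
        (y₁ , y₁≢a , _ , uy₁ , y₁w) = step a≢a′ ua ua′
        (y₂ , _ , y₂≢y₁ , uy₂ , y₂w) = step (≢-sym y₁≢a) ua uy₁
        (y₃ , y₃≢y₁ , y₃≢y₂ , uy₃ , y₃w) = step (≢-sym y₂≢y₁) uy₁ uy₂
    in 3≤count (λ v → G u v ∧ G v w) (≢-sym y₂≢y₁) (≢-sym y₃≢y₁) (≢-sym y₃≢y₂)
         (∧-intro uy₁ y₁w) (∧-intro uy₂ y₂w) (∧-intro uy₃ y₃w)
    where
    step : ∀ {a a′} → a ≢ a′ → G u a ≡ true → G u a′ ≡ true →
           ∃ λ y → y ≢ a × y ≢ a′ × G u y ≡ true × G y w ≡ true
    step = non-neighbour-codegree-step w≢u uw

  codegree-self : codegree G u u ≡ count (G u ∘ punchIn u)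
  codegree-self = begin
    codegree G u u                                ≡⟨ sum-cong-≗ (cong indicator ∘ selfTerm) ⟩
    count (G u)                                   ≡⟨ count-split (G u) u ⟩
    indicator (G u u) + count (G u ∘ punchIn u)   ≡⟨ cong (λ b → indicator b + count (G u ∘ punchIn u))
                                                          (proj₂ simple u) ⟩
    count (G u ∘ punchIn u)                       ∎
    where
    open ≡-Reasoning
    selfTerm : ∀ v → (G u v ∧ G v u) ≡ G u v
    selfTerm v = trans (cong (G u v ∧_) (G-sym v u)) (∧-idem (G u v))

  neighbourDegSum-lowerBound : 2 ≤ deg G u → (2 + n) * 3 ≤ neighbourDegSum G u
  neighbourDegSum-lowerBound 2≤deg = begin
    (2 + n) * 3
      ≤⟨ n*k≤sum term 3≤term ⟩
    sum term
      ≡⟨ ∑-distrib-+ (indicator ∘ G u ∘ punchIn u) (codegree G u ∘ punchIn u) ⟩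
    count (G u ∘ punchIn u) + sum (codegree G u ∘ punchIn u)
      ≡⟨ cong (_+ sum (codegree G u ∘ punchIn u)) codegree-self ⟨
    codegree G u u + sum (codegree G u ∘ punchIn u)
      ≡⟨ sum-remove (codegree G u) ⟨
    sum (codegree G u)
      ≡⟨ neighbourDegSum≡∑codegree G u ⟨
    neighbourDegSum G u
      ∎
    where
    open ≤-Reasoning
    term : Fin (2 + n) → ℕ
    term j = indicator (G u (punchIn u j)) + codegree G u (punchIn u j)
    3≤term : ∀ j → 3 ≤ term j
    3≤term j with G u (punchIn u j) in uj
    ... | true  = s≤s (2≤codegree-neighbour 2≤deg uj)
    ... | false = 3≤codegree-non-neighbour 2≤deg (punchInᵢ≢i u j) uj

lemma14 : (G : Adj 15) → IsSimple G → (u : Fin 15) → deg G u ≡ 6 →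
    NonCompliant3 G → 42 ≤ neighbourDegSum G u
lemma14 G simple u deg≡6 nc = neighbourDegSum-lowerBound {12} G simple nc u 2≤deg
  where
  2≤deg : 2 ≤ deg G u
  2≤deg = subst (2 ≤_) (sym deg≡6) (s≤s (s≤s z≤n))
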